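{- Let $P=(I,\emptyset,\{\omega\})$ be a reduced presentation and let $\mathbf B_\Delta$ be the algebra associated with $P$ as defined below. Then $\mathbf C_\omega$ is embeddable in $\mathbf B_\Delta$.
   Context: A Wajsberg hoop is a commutative integral residuated lattice $\langle A,\vee,\wedge,\cdot,\rightarrow,1\rangle$ satisfying $(x\rightarrow y)\vee(y\rightarrow x)\approx1$, $x(x\rightarrow y)\approx y(y\rightarrow x)$ and $(x\rightarrow y)\rightarrow y\approx(y\rightarrow x)\rightarrow x$. $\mathbf{Ł}_n$ is the Wajsberg chain on $\{0,1,\dots,n\}$ with $a\cdot b=\max\{a+b-n,0\}$, $a\rightarrow b=\min\{n-a+b,n\}$, top $n$. $\mathbf C_\omega$ is the negative cone of $\mathbb Z$: universe $\{0,-1,-2,\dots\}$, product given by addition, $a\rightarrow b=\min\{0,b-a\}$, top $0$, generator $c=-1$. A reduced presentation of the form $(I,\emptyset,\{\omega\})$ is one where $I$ is a finite set of positive integers such that no $m\in I$ divides any element of $I\setminus\{m\}$. For such $P$, let $I{\downarrow}$ be the set of divisors of elements of $I$, $\Delta=\{(k,h,2):0\le h<k\in I{\downarrow},\ \gcd(k,h)=1\}\cup\{(0,0,3)\}$, $\mathbf A_\Delta=\prod_{(k,h,2)}\mathbf{Ł}_k\times\mathbf C_\omega$ (the factor indexed by $(k,h,2)$ being $\mathbf{Ł}_k$ and the one indexed by $(0,0,3)$ being $\mathbf C_\omega$), $\bar g\in A_\Delta$ given by $\bar g(k,h,2)=h$ and $\bar g(0,0,3)=c$, and $\mathbf B_\Delta$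 the subalgebra of $\mathbf A_\Delta$ generated by $\bar g$. -}

module Defs where

open import Data.Nat using (ℕ; zero; suc; _+_; _∸_; _⊔_; _⊓_; _<_)
open import Data.Nat.Divisibility using (_∣_)
open import Data.Nat.GCD using (gcd)
open import Data.List using (List)
open import Data.List.Membership.Propositional using (_∈_)
open import Data.Product using (Σ; ∃; _×_)
open import Relation.Binary.PropositionalEquality using (_≡_)

-- The Wajsberg chain Ł_k on {0,…,k} (elements represented by naturals ≤ k)

Łjoin Łmeet Łmul Łimp : ℕ → ℕ → ℕ → ℕ
Łjoin k a b = a ⊔ b
Łmeet k a b = a ⊓ b
Łmul  k a b = (a + b) ∸ k
Łimp  k a b = k ∸ (a ∸ b)            -- min{k-a+b,k}  (for a,b ≤ k)

-- C_ω, the negative cone of ℤ.  The natural number n represents -n.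

Cω : Set
Cω = ℕ

Ctop : Cω
Ctop = 0

Cgen : Cω
Cgen = 1

Cjoin Cmeet Cmul Cimp : Cω → Cω → Cω
Cjoin a b = a ⊓ b          -- max{-a,-b} = -(min{a,b})
Cmeet a b = a ⊔ b          -- min{-a,-b} = -(max{a,b})
Cmul  a b = a + b
Cimp  a b = b ∸ a          -- min{0,-b+a} = -(b ∸ a)

-- Reduced presentations (I, ∅, {ω}): I a finite set of positive integers,
-- given as a list, no element dividing a different element.

record ReducedPres : Set where
  field
    I        : List ℕ
    positive : ∀ {m} → m ∈ I → 0 < m
    reduced  : ∀ {m n} → m ∈ I → n ∈ I → m ∣ n → m ≡ n

open ReducedPres public

_∈I↓_ : ℕ → ReducedPres → Set
k ∈I↓ P = ∃ λ m → m ∈ I P × k ∣ m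

InΔ : ReducedPres → ℕ → ℕ → Set
InΔ P k h = k ∈I↓ P × h < k × gcd k h ≡ 1

-- A_Δ = ∏_{(k,h,2) ∈ Δ} Ł_k × C_ω.
-- An element is given by its Ł-coordinates (a function of (k,h), only
-- the values at indices in Δ matter) and its C_ω-coordinate (index (0,0,3)).

record AΔ : Set where
  constructor mkA
  field
    ł  : ℕ → ℕ → ℕ
    cw : Cω

open AΔ public

_≈[_]_ : AΔ → ReducedPres → AΔ → Set
x ≈[ P ] y = (∀ k h → InΔ P k h → ł x k h ≡ ł y k h) × cw x ≡ cw y

Atop : AΔ
Atop = mkA (λ k h → k) Ctop

Ajoin Ameet Amul Aimp : AΔ → AΔ → AΔ
Ajoin x y = mkA (λ k h → Łjoin k (ł x k h) (ł y k h)) (Cjoin (cw x) (cw y))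
Ameet x y = mkA (λ k h → Łmeet k (ł x k h) (ł y k h)) (Cmeet (cw x) (cw y))
Amul  x y = mkA (λ k h → Łmul  k (ł x k h) (ł y k h)) (Cmul  (cw x) (cw y))
Aimp  x y = mkA (λ k h → Łimp  k (ł x k h) (ł y k h)) (Cimp  (cw x) (cw y))

ḡ : AΔ
ḡ = mkA (λ k h → h) Cgen

data Gen : AΔ → Set where
  gen-g    : Gen ḡ
  gen-top  : Gen Atop
  gen-join : ∀ {x y} → Gen x → Gen y → Gen (Ajoin x y)
  gen-meet : ∀ {x y} → Gen x → Gen y → Gen (Ameet x y)
  gen-mul  : ∀ {x y} → Gen x → Gen y → Gen (Amul x y)
  gen-imp  : ∀ {x y} → Gen x → Gen y → Gen (Aimp x y)

InB : ReducedPres → AΔ → Set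
InB P x = ∃ λ y → Gen y × y ≈[ P ] x

record EmbedCωB (P : ReducedPres) : Set where
  field
    φ         : Cω → AΔ
    into-B    : ∀ a → InB P (φ a)
    pres-top  : φ Ctop ≈[ P ] Atop
    pres-join : ∀ a b → φ (Cjoin a b) ≈[ P ] Ajoin (φ a) (φ b)
    pres-meet : ∀ a b → φ (Cmeet a b) ≈[ P ] Ameet (φ a) (φ b)
    pres-mul  : ∀ a b → φ (Cmul a b)  ≈[ P ] Amul (φ a) (φ b)
    pres-imp  : ∀ a b → φ (Cimp a b)  ≈[ P ] Aimp (φ a) (φ b)
    injective : ∀ a b → φ a ≈[ P ] φ b → a ≡ b

module Submission where

-- φ sends c^n to the element that is the top on every Ł_k-coordinate and c^n on
-- the C_ω-coordinate; it is clearly an injective homomorphism. It lands in B_Δ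
-- because for N ≥ every k ∈ I↓ the power ḡ^N vanishes on every Ł_k-coordinate
-- (there h < k, so each further factor ḡ lowers the coordinate), hence
-- ḡ^N → ḡ^(N+n) is the top on those coordinates and c^n on C_ω.

open import Defs
open import Data.Nat using (ℕ; zero; suc; _+_; _∸_; _≤_; _<_; pred; >-nonZero)
open import Data.Nat.Properties
open import Data.Nat.Divisibility using (∣⇒≤)
open import Data.Nat.ListAction using (sum)
open import Data.List using (_∷_)
open import Data.List.Membership.Propositional using (_∈_)
open import Data.List.Relation.Unary.Any using (here; there)
open import Data.Product using (_,_; proj₂)
open import Relation.Binary.PropositionalEquality using (_≡_; refl; sym; cong)

∈⇒≤sum : ∀ {n ns} → n ∈ ns → n ≤ sum ns
∈⇒≤sum {ns = m ∷ ms} (here refl) = m≤m+n m (sum ms)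
∈⇒≤sum {ns = m ∷ ms} (there n∈ms) = ≤-trans (∈⇒≤sum n∈ms) (m≤n+m (sum ms) m)

∈I↓⇒≤sum : ∀ P {k} → k ∈I↓ P → k ≤ sum (I P)
∈I↓⇒≤sum P (m , m∈I , k∣m) =
  ≤-trans (∣⇒≤ {{>-nonZero (positive P m∈I)}} k∣m) (∈⇒≤sum m∈I)

Łmul-≤-pred : ∀ k a b → a < k → Łmul k a b ≤ pred b
Łmul-≤-pred k a zero    a<k rewrite +-identityʳ a = ≤-reflexive (m≤n⇒m∸n≡0 (<⇒≤ a<k))
Łmul-≤-pred k a (suc b) a<k = begin
  (a + suc b) ∸ k ≡⟨ cong (_∸ k) (+-comm a (suc b)) ⟩
  (suc b + a) ∸ k ≤⟨ ∸-monoʳ-≤ (suc b + a) a<k ⟩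
  (suc b + a) ∸ suc a ≡⟨ m+n∸n≡m b a ⟩
  b ∎
  where open ≤-Reasoning

ḡ^ : ℕ → AΔ
ḡ^ zero    = Atop
ḡ^ (suc p) = Amul ḡ (ḡ^ p)

Gen-ḡ^ : ∀ p → Gen (ḡ^ p)
Gen-ḡ^ zero    = gen-top
Gen-ḡ^ (suc p) = gen-mul gen-g (Gen-ḡ^ p)

cw-ḡ^ : ∀ p → cw (ḡ^ p) ≡ p
cw-ḡ^ zero    = refl
cw-ḡ^ (suc p) = cong suc (cw-ḡ^ p)

ł-ḡ^-≤ : ∀ {k h} → h < k → ∀ p → ł (ḡ^ p) k h ≤ k ∸ p
ł-ḡ^-≤ h<k zero    = ≤-refl
ł-ḡ^-≤ {k} {h} h<k (suc p) = begin
  Łmul k h (ł (ḡ^ p) k h) ≤⟨ Łmul-≤-pred k h _ h<k ⟩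
  pred (ł (ḡ^ p) k h)     ≤⟨ pred-mono-≤ (ł-ḡ^-≤ h<k p) ⟩
  pred (k ∸ p)            ≡⟨ pred[m∸n]≡m∸[1+n] k p ⟩
  k ∸ suc p               ∎
  where open ≤-Reasoning

ł-ḡ^-≡0 : ∀ {k h p} → h < k → k ≤ p → ł (ḡ^ p) k h ≡ 0
ł-ḡ^-≡0 {p = p} h<k k≤p =
  n≤0⇒n≡0 (≤-trans (ł-ḡ^-≤ h<k p) (≤-reflexive (m≤n⇒m∸n≡0 k≤p)))

topŁ : Cω → AΔ
topŁ n = mkA (λ k h → k) n

topŁ∈B : ∀ P n → InB P (topŁ n)
topŁ∈B P n =
  Aimp (ḡ^ N) (ḡ^ (N + n)) , gen-imp (Gen-ḡ^ N) (Gen-ḡ^ (N + n)) , łtop , cwn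
  where
  N = sum (I P)
  łtop : ∀ k h → InΔ P k h → Łimp k (ł (ḡ^ N) k h) (ł (ḡ^ (N + n)) k h) ≡ k
  łtop k h (k∈I↓ , h<k , _)
    rewrite ł-ḡ^-≡0 h<k (∈I↓⇒≤sum P k∈I↓) | 0∸n≡0 (ł (ḡ^ (N + n)) k h) = refl
  cwn : cw (ḡ^ (N + n)) ∸ cw (ḡ^ N) ≡ n
  cwn rewrite cw-ḡ^ (N + n) | cw-ḡ^ N = m+n∸m≡n N n

theorem3p11 : (P : ReducedPres) → EmbedCωB P
theorem3p11 P = record
  { φ         = topŁ
  ; into-B    = topŁ∈B P
  ; pres-top  = (λ _ _ _ → refl) , refl
  ; pres-join = λ _ _ → (λ k _ _ → sym (⊔-idem k)) , refl
  ; pres-meet = λ _ _ → (λ k _ _ → sym (⊓-idem k)) , refl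
  ; pres-mul  = λ _ _ → (λ k _ _ → sym (m+n∸n≡m k k)) , refl
  ; pres-imp  = λ _ _ → (λ k _ _ → sym (cong (k ∸_) (n∸n≡0 k))) , refl
  ; injective = λ _ _ → proj₂
  }
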